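{- Let $p$ be a permutation of length $n$, and let $N(p)$ be its normalization. Then $p$ is indecomposable if and only if $N(p)$ is indecomposable.
   Context: A permutation $p=(p_1,\dots,p_n)$ is decomposable if there is $1\le m<n$ such that every entry among $p_1,\dots,p_m$ is larger than every entry among $p_{m+1},\dots,p_n$; otherwise it is indecomposable. An entry $p_i$ is a left-to-right minimum if $p_i<p_j$ for all $j<i$. Two permutations of length $n$ are in the same class if they have the same left-to-right minima in the same positions. Each class contains exactly one $132$-avoiding permutation (no indices $i<j<k$ with $p_i<p_k<p_j$); the normalization $N(p)$ is the unique $132$-avoiding permutation in the class of $p$. -}

module Defs where

open import Data.Nat using (ℕ; _≤_)
open import Data.Fin using (Fin; toℕ; _<_)
open import Data.Fin.Permutation using (Permutation; _⟨$⟩ʳ_)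
open import Data.Product using (Σ; ∃; _×_)
open import Relation.Nullary using (¬_)
open import Relation.Binary.PropositionalEquality using (_≡_)
open import Function.Bundles using (_⇔_)

Perm : ℕ → Set
Perm n = Permutation n n

Decomposable : ∀ {n} → Perm n → Set
Decomposable {n} p =
  Σ ℕ λ m → (1 ≤ m) × (m Data.Nat.< n) ×
    (∀ (i j : Fin n) → toℕ i Data.Nat.< m → m ≤ toℕ j → (p ⟨$⟩ʳ j) < (p ⟨$⟩ʳ i))

Indecomposable : ∀ {n} → Perm n → Set
Indecomposable p = ¬ Decomposable p

LRMin : ∀ {n} → Perm n → Fin n → Set
LRMin {n} p i = ∀ (j : Fin n) → j < i → (p ⟨$⟩ʳ i) < (p ⟨$⟩ʳ j)

SameClass : ∀ {n} → Perm n → Perm n → Set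
SameClass {n} p q =
  ∀ (i : Fin n) → (LRMin p i ⇔ LRMin q i) × (LRMin p i → p ⟨$⟩ʳ i ≡ q ⟨$⟩ʳ i)

Contains132 : ∀ {n} → Perm n → Set
Contains132 {n} p =
  Σ (Fin n) λ i → Σ (Fin n) λ j → Σ (Fin n) λ k →
    (i < j) × (j < k) × ((p ⟨$⟩ʳ i) < (p ⟨$⟩ʳ k)) × ((p ⟨$⟩ʳ k) < (p ⟨$⟩ʳ j))

Avoids132 : ∀ {n} → Perm n → Set
Avoids132 p = ¬ Contains132 p

-- q is the normalization N(p): the (unique) 132-avoiding permutation in the class of p.
IsNormalization : ∀ {n} → Perm n → Perm n → Set
IsNormalization p q = SameClass p q × Avoids132 q

{-# OPTIONS --safe #-}
-- A permutation of length n decomposes after position m iff its first m entries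
-- are the m largest values, i.e. iff all of them are ≥ n - m; both directions are
-- pigeonhole counts. Whether a prefix lies above a bound depends only on the prefix
-- minimum, which sits at a left-to-right minimum and is therefore common to the
-- whole class. So decomposability is a class invariant.
module Submission where

open import Defs
open import Data.Fin
  using (Fin; zero; suc; toℕ; fromℕ<; inject≤; cast; _↑ʳ_; opposite; _≤_; _<_)
open import Data.Fin.Induction using (<-wellFounded)
open import Data.Fin.Permutation using (_⟨$⟩ʳ_)
open import Data.Fin.Properties
  using ( toℕ-injective; toℕ<n; fromℕ<-injective; toℕ-inject≤; inject≤-injective
        ; toℕ-cast; toℕ-↑ʳ; opposite-prop; opposite-involutive
        ; injective⇒≤; any?; _<?_; ≤∧≢⇒<; <⇒≢ )
open import Data.Nat as ℕ using (ℕ; suc; _+_; _∸_; s≤s)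
import Data.Nat.Properties as ℕₚ
open import Data.Product using (∃; _×_; _,_; proj₁; proj₂)
open import Data.Sum using (_⊎_; inj₁; inj₂)
open import Data.Vec.Functional using (_∷_)
open import Function using (_∘_)
open import Function.Bundles using (_⇔_; mk⇔; Equivalence; Injection)
open import Function.Definitions using (Injective)
open import Function.Properties.Inverse using (↔⇒↣)
open import Induction.WellFounded using (module All)
open import Relation.Nullary using (yes; no; contradiction)
open import Relation.Nullary.Decidable using (_×-dec_)
open import Relation.Binary.PropositionalEquality
  using (_≡_; _≢_; refl; sym; trans; cong; subst)

injective-below⇒≤ : ∀ {k n m} (g : Fin k → Fin n) → Injective _≡_ _≡_ g →
                    (∀ x → toℕ (g x) ℕ.< m) → k ℕ.≤ m
injective-below⇒≤ g g-injective g<m =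
  injective⇒≤ {f = λ x → fromℕ< (g<m x)}
    (λ {x} {y} e → g-injective (toℕ-injective (fromℕ<-injective _ _ (g<m x) (g<m y) e)))

opposite-injective : ∀ {n} → Injective _≡_ _≡_ (opposite {n})
opposite-injective {x = i} {j} e =
  trans (sym (opposite-involutive i)) (trans (cong opposite e) (opposite-involutive j))

injective-above⇒≤ : ∀ {k n c} (g : Fin k → Fin n) → Injective _≡_ _≡_ g →
                    (∀ x → c ℕ.≤ toℕ (g x)) → k ℕ.≤ n ∸ c
injective-above⇒≤ {n = n} {c} g g-injective c≤g =
  injective-below⇒≤ (opposite ∘ g) (g-injective ∘ opposite-injective) opposite-below
  where
  opposite-below : ∀ x → toℕ (opposite (g x)) ℕ.< n ∸ c
  opposite-below x = subst (ℕ._< n ∸ c) (sym (opposite-prop (g x)))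
    (ℕₚ.∸-monoʳ-< (s≤s (c≤g x)) (toℕ<n (g x)))

shift : ∀ {m n} → m ℕ.≤ n → Fin (n ∸ m) → Fin n
shift {m} m≤n k = cast (ℕₚ.m+[n∸m]≡n m≤n) (m ↑ʳ k)

toℕ-shift : ∀ {m n} (m≤n : m ℕ.≤ n) (k : Fin (n ∸ m)) → toℕ (shift m≤n k) ≡ m + toℕ k
toℕ-shift {m} m≤n k = trans (toℕ-cast _ (m ↑ʳ k)) (toℕ-↑ʳ m k)

shift-injective : ∀ {m n} (m≤n : m ℕ.≤ n) → Injective _≡_ _≡_ (shift m≤n)
shift-injective {m} m≤n {k} {l} e = toℕ-injective (ℕₚ.+-cancelˡ-≡ m _ _
  (trans (sym (toℕ-shift m≤n k)) (trans (cong toℕ e) (toℕ-shift m≤n l))))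

DecomposesAt : ∀ {n} → Perm n → ℕ → Set
DecomposesAt {n} p m =
  ∀ (i j : Fin n) → toℕ i ℕ.< m → m ℕ.≤ toℕ j → (p ⟨$⟩ʳ j) < (p ⟨$⟩ʳ i)

PrefixAtLeast : ∀ {n} → Perm n → ℕ → ℕ → Set
PrefixAtLeast {n} p m c = ∀ (i : Fin n) → toℕ i ℕ.< m → c ℕ.≤ toℕ (p ⟨$⟩ʳ i)

module _ {n : ℕ} (p : Perm n) where

  ⟨$⟩ʳ-injective : Injective _≡_ _≡_ (p ⟨$⟩ʳ_)
  ⟨$⟩ʳ-injective = Injection.injective (↔⇒↣ p)

  suffixBelow⇒≤ : ∀ {m c} → m ℕ.≤ n →
                  (∀ j → m ℕ.≤ toℕ j → toℕ (p ⟨$⟩ʳ j) ℕ.< c) → n ∸ m ℕ.≤ c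
  suffixBelow⇒≤ {m} m≤n below =
    injective-below⇒≤ ((p ⟨$⟩ʳ_) ∘ shift m≤n) (shift-injective m≤n ∘ ⟨$⟩ʳ-injective)
      (λ k → below (shift m≤n k)
        (subst (m ℕ.≤_) (sym (toℕ-shift m≤n k)) (ℕₚ.m≤m+n m (toℕ k))))

  prefixAtLeast⇒suc≤ : ∀ {m c} → m ℕ.≤ n → PrefixAtLeast p m c →
                       ∀ j → m ℕ.≤ toℕ j → c ℕ.≤ toℕ (p ⟨$⟩ʳ j) → suc m ℕ.≤ n ∸ c
  prefixAtLeast⇒suc≤ {m} {c} m≤n prefix j m≤j c≤pj =
    injective-above⇒≤ ((p ⟨$⟩ʳ_) ∘ positions) (positions-injective ∘ ⟨$⟩ʳ-injective) above
    where
    positions : Fin (suc m) → Fin n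
    positions = j ∷ λ i → inject≤ i m≤n

    prefix-position : ∀ i → toℕ (inject≤ i m≤n) ℕ.< m
    prefix-position i = subst (ℕ._< m) (sym (toℕ-inject≤ i m≤n)) (toℕ<n i)

    j≢prefix : ∀ i → j ≢ inject≤ i m≤n
    j≢prefix i e = ℕₚ.≤⇒≯ m≤j (subst (ℕ._< m) (cong toℕ (sym e)) (prefix-position i))

    positions-injective : Injective _≡_ _≡_ positions
    positions-injective {zero}  {zero}  _ = refl
    positions-injective {zero}  {suc y} e = contradiction e (j≢prefix y)
    positions-injective {suc x} {zero}  e = contradiction (sym e) (j≢prefix x)
    positions-injective {suc x} {suc y} e = cong suc (inject≤-injective m≤n m≤n x y e)

    above : ∀ x → c ℕ.≤ toℕ (p ⟨$⟩ʳ positions x)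
    above zero    = c≤pj
    above (suc i) = prefix (inject≤ i m≤n) (prefix-position i)

  prefixAtLeast⇒suffixBelow : ∀ {m} → m ℕ.≤ n → PrefixAtLeast p m (n ∸ m) →
                              ∀ j → m ℕ.≤ toℕ j → toℕ (p ⟨$⟩ʳ j) ℕ.< n ∸ m
  prefixAtLeast⇒suffixBelow {m} m≤n prefix j m≤j = ℕₚ.≰⇒> λ n∸m≤pj →
    ℕₚ.n≮n m (subst (suc m ℕ.≤_) (ℕₚ.m∸[m∸n]≡n m≤n)
      (prefixAtLeast⇒suc≤ m≤n prefix j m≤j n∸m≤pj))

  decomposesAt⇔prefixAtLeast : ∀ {m} → m ℕ.≤ n → DecomposesAt p m ⇔ PrefixAtLeast p m (n ∸ m)
  decomposesAt⇔prefixAtLeast m≤n = mk⇔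
    (λ decomposes i i<m → suffixBelow⇒≤ m≤n (λ j m≤j → decomposes i j i<m m≤j))
    (λ prefix i j i<m m≤j →
      ℕₚ.<-≤-trans (prefixAtLeast⇒suffixBelow m≤n prefix j m≤j) (prefix i i<m))

  earlierSmaller⊎lrMin : ∀ i → (∃ λ j → j < i × p ⟨$⟩ʳ j < p ⟨$⟩ʳ i) ⊎ LRMin p i
  earlierSmaller⊎lrMin i with any? (λ j → (j <? i) ×-dec (p ⟨$⟩ʳ j <? p ⟨$⟩ʳ i))
  ... | yes earlier = inj₁ earlier
  ... | no ∄earlier = inj₂ λ j j<i →
    ≤∧≢⇒< (ℕₚ.≮⇒≥ λ pj<pi → ∄earlier (j , j<i , pj<pi))
          (λ e → <⇒≢ j<i (sym (⟨$⟩ʳ-injective e)))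

  LRMinAtOrBefore : Fin n → Set
  LRMinAtOrBefore i = ∃ λ a → a ≤ i × LRMin p a × p ⟨$⟩ʳ a ≤ p ⟨$⟩ʳ i

  lrMinAtOrBefore : ∀ i → LRMinAtOrBefore i
  lrMinAtOrBefore = All.wfRec <-wellFounded _ LRMinAtOrBefore step
    where
    step : ∀ i → (∀ {j} → j < i → LRMinAtOrBefore j) → LRMinAtOrBefore i
    step i rec with earlierSmaller⊎lrMin i
    ... | inj₂ i-min = i , ℕₚ.≤-refl , i-min , ℕₚ.≤-refl
    ... | inj₁ (j , j<i , pj<pi) with rec j<i
    ...   | a , a≤j , a-min , pa≤pj =
      a , ℕₚ.≤-trans a≤j (ℕₚ.<⇒≤ j<i) , a-min , ℕₚ.≤-trans pa≤pj (ℕₚ.<⇒≤ pj<pi)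

module _ {n : ℕ} (p q : Perm n) (same : SameClass p q) where

  sameClass-sym : SameClass q p
  sameClass-sym i = mk⇔ (Equivalence.from (proj₁ (same i))) (Equivalence.to (proj₁ (same i)))
                  , λ q-min → sym (proj₂ (same i) (Equivalence.from (proj₁ (same i)) q-min))

  prefixAtLeast-transfer : ∀ {m c} → PrefixAtLeast q m c → PrefixAtLeast p m c
  prefixAtLeast-transfer {m} {c} q-prefix i i<m with lrMinAtOrBefore p i
  ... | a , a≤i , a-min , pa≤pi = ℕₚ.≤-trans c≤pa pa≤pi
    where
    c≤pa : c ℕ.≤ toℕ (p ⟨$⟩ʳ a)
    c≤pa = subst (λ v → c ℕ.≤ toℕ v) (sym (proj₂ (same a) a-min))
                 (q-prefix a (ℕₚ.≤-<-trans a≤i i<m))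

  decomposable-transfer : Decomposable q → Decomposable p
  decomposable-transfer (m , 1≤m , m<n , q-decomposes) = m , 1≤m , m<n ,
    Equivalence.from (decomposesAt⇔prefixAtLeast p m≤n)
      (prefixAtLeast-transfer (Equivalence.to (decomposesAt⇔prefixAtLeast q m≤n) q-decomposes))
    where
    m≤n : m ℕ.≤ n
    m≤n = ℕₚ.<⇒≤ m<n

mainTheorem4 : (n : ℕ) (p q : Perm n) → IsNormalization p q →
    (Indecomposable p ⇔ Indecomposable q)
mainTheorem4 n p q (same , _) = mk⇔
  (λ p-indecomposable → p-indecomposable ∘ decomposable-transfer p q same)
  (λ q-indecomposable → q-indecomposable ∘ decomposable-transfer q p (sameClass-sym p q same))
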